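{- Let $D=(E,\mathcal{F})$ be a binary delta-matroid. If every element of $E$ has primal type $u$ in $D$, then $D$ is even.
   Context: A set system is a pair $D=(E,\mathcal{F})$ with $E$ finite and $\mathcal{F}$ a collection of subsets of $E$. A delta-matroid is a set system with $\mathcal{F}\neq\emptyset$ such that for any $X,Y\in\mathcal{F}$ and any $u\in X\Delta Y$ there exists $v\in X\Delta Y$ (possibly $v=u$) with $X\Delta\{u,v\}\in\mathcal{F}$. For $A\subseteq E$, $D*A=(E,\{A\Delta X\mid X\in\mathcal{F}\})$; $D*e=D*\{e\}$. For a symmetric matrix $C$ over $\mathrm{GF}(2)$ indexed by $E$, $D(C)=(E,\{A\subseteq E\mid C[A]\text{ non-singular}\})$ with $C[\emptyset]$ considered non-singular; a delta-matroid is binary if some twist of it is isomorphic to some $D(C)$. $D$ is even if $|X\Delta Y|$ is even for all $X,Y\in\mathcal{F}$. Let $D_{\min}=(E,\mathcal{F}_{\min}(D))$ where $\mathcal{F}_{\min}(D)$ is the set of minimum-cardinality feasible sets; $e$ is a loop of a set system if it lies in no feasible set. An element $e$ is a ribbon loop of $D$ if it is a loop of $D_{\min}$; a ribbon loop $e$ is orientable if it is not a ribbon loop in $D*e$. The element $e$ has primal type $u$ in $D$ if it is an orientable ribbon loop. -}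

module Defs where

open import Data.Nat using (ℕ; zero; suc; _≤_)
open import Data.Nat.Divisibility using (_∣_)
open import Data.Bool using (Bool; true; false; _∧_; _xor_)
open import Data.Fin using (Fin)
import Data.Fin as F
open import Data.Fin.Subset using (Subset; _∈_; _∉_; _⊆_; ⁅_⁆; ∣_∣) renaming (⊥ to ∅)
open import Data.Fin.Permutation using (Permutation′; _⟨$⟩ʳ_; _⟨$⟩ˡ_)
open import Data.Vec using (Vec; zipWith; tabulate; lookup)
open import Data.Product using (Σ; ∃; _×_; _,_)
open import Relation.Binary.PropositionalEquality using (_≡_)
open import Relation.Nullary using (¬_)
open import Function.Bundles using (_⇔_)

-- A set system on the ground set E = Fin n: the collection 𝓕 is given
-- as a predicate on subsets of Fin n (X ∈ 𝓕 iff Fam X holds).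
record SetSystem (n : ℕ) : Set₁ where
  constructor mkSS
  field
    Fam : Subset n → Set
open SetSystem public

_Δ_ : ∀ {n} → Subset n → Subset n → Subset n
X Δ Y = zipWith _xor_ X Y

IsDeltaMatroid : ∀ {n} → SetSystem n → Set
IsDeltaMatroid {n} D =
  (Σ (Subset n) λ X → Fam D X) ×
  (∀ X Y → Fam D X → Fam D Y → ∀ u → u ∈ (X Δ Y) →
     Σ (Fin n) λ v → v ∈ (X Δ Y) × Fam D (X Δ (⁅ u ⁆ Δ ⁅ v ⁆)))

_*_ : ∀ {n} → SetSystem n → Subset n → SetSystem n
D * A = mkSS (λ Y → Fam D (A Δ Y))

_*ₑ_ : ∀ {n} → SetSystem n → Fin n → SetSystem n
D *ₑ e = D * ⁅ e ⁆

xorSum : ∀ {n} → (Fin n → Bool) → Bool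
xorSum {zero}  f = false
xorSum {suc n} f = f F.zero xor xorSum (λ i → f (F.suc i))

-- matrices over GF(2) = Bool (with xor as addition and ∧ as multiplication)
Matrix : ℕ → Set
Matrix n = Fin n → Fin n → Bool

Symmetric : ∀ {n} → Matrix n → Set
Symmetric C = ∀ i j → C i j ≡ C j i

mulVec : ∀ {n} → Matrix n → Subset n → Fin n → Bool
mulVec C x i = xorSum (λ j → C i j ∧ lookup x j)

-- The principal submatrix C[A] is non-singular: its only kernel vector
-- (a vector supported on A, killed by C[A]) is zero.  For A = ∅ this holds.
NonSingular : ∀ {n} → Matrix n → Subset n → Set
NonSingular C A =
  ∀ x → x ⊆ A → (∀ i → i ∈ A → mulVec C x i ≡ false) → x ≡ ∅

DC : ∀ {n} → Matrix n → SetSystem n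
DC C = mkSS (λ A → NonSingular C A)

-- image of a subset under a bijection φ = (π ⟨$⟩ʳ_) of Fin n
image : ∀ {n} → Permutation′ n → Subset n → Subset n
image π X = tabulate (λ j → lookup X (π ⟨$⟩ˡ j))

Isomorphic : ∀ {n} → SetSystem n → SetSystem n → Set
Isomorphic {n} D D' =
  Σ (Permutation′ n) λ π → ∀ X → Fam D X ⇔ Fam D' (image π X)

-- binary: some twist is isomorphic to some D(C), C symmetric over GF(2)
-- (C can be indexed by Fin n since the ground sets are in bijection)
IsBinary : ∀ {n} → SetSystem n → Set
IsBinary {n} D =
  Σ (Subset n) λ A → Σ (Matrix n) λ C → Symmetric C × Isomorphic (D * A) (DC C)

IsEven : ∀ {n} → SetSystem n → Set
IsEven D = ∀ X Y → Fam D X → Fam D Y → 2 ∣ ∣ X Δ Y ∣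

Dmin : ∀ {n} → SetSystem n → SetSystem n
Dmin D = mkSS (λ X → Fam D X × (∀ Y → Fam D Y → ∣ X ∣ ≤ ∣ Y ∣))

IsLoop : ∀ {n} → SetSystem n → Fin n → Set
IsLoop D e = ∀ X → Fam D X → e ∉ X

IsRibbonLoop : ∀ {n} → SetSystem n → Fin n → Set
IsRibbonLoop D e = IsLoop (Dmin D) e

IsOrientableRibbonLoop : ∀ {n} → SetSystem n → Fin n → Set
IsOrientableRibbonLoop D e = IsRibbonLoop D e × ¬ IsRibbonLoop (D *ₑ e) e

PrimalTypeU : ∀ {n} → SetSystem n → Fin n → Set
PrimalTypeU D e = IsOrientableRibbonLoop D e

{-# OPTIONS --safe #-}
module Submission where

-- Every element is a ribbon loop, so a minimum feasible set is empty: ∅ is feasible.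
-- Orientability then says that no singleton is feasible. In a representation
-- D * A ≅ D(C) with S the image of A, this means that C[S] is non-singular while
-- every C[S Δ {e}] is singular. Over GF(2) the quadratic form q(x) = xᵀCx of a
-- symmetric C is additive with q({i}) = C_ii, and it vanishes on kernel vectors of
-- the singular C[S Δ {e}]; these kernel vectors span, so C has zero diagonal.
-- A non-singular principal submatrix of an alternating matrix has even size (split
-- off a hyperbolic pair and recurse). Hence |A Δ X| is even for every feasible X.

open import Defs
open import Algebra.Bundles using (CommutativeRing)
import Algebra.Properties.CommutativeSemigroup as CommutativeSemigroupProperties
open import Data.Bool using (Bool; true; false; _∧_; _xor_; if_then_else_)
open import Data.Bool.Properties as Bool
  using ( xor-∧-commutativeRing; xor-same; xor-identityˡ; xor-identityʳ; xor-assoc; xor-comm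
        ; ∧-comm; ∧-zeroʳ; ∧-identityʳ; ∧-distribˡ-xor; ∧-distribʳ-xor; ¬-not; not-injective)
open import Data.Empty using (⊥-elim)
open import Data.Fin using (Fin; zero; suc)
open import Data.Fin.Properties using (_≟_; any?; all?)
open import Data.Fin.Permutation using (Permutation′; _⟨$⟩ʳ_; _⟨$⟩ˡ_; inverseˡ; inverseʳ; flip)
open import Data.Fin.Subset using (Subset; _∈_; _∉_; _⊆_; ⁅_⁆; ∣_∣) renaming (⊥ to ∅)
open import Data.Fin.Subset.Properties
  using ( _∈?_; _⊆?_; ⊆-antisym; nonempty?; Empty-unique; anySubset?
        ; x∈⁅x⁆; x∈⁅y⁆⇒x≡y; ∉⊥; ∣⊥∣≡0; x∈p⇒∣p-x∣<∣p∣)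
open import Data.Nat using (ℕ; suc; _≤_; _<_; s≤s)
open import Data.Nat.Divisibility using (_∣_; _∣0; ∣-refl; ∣m∣n⇒∣m+n)
open import Data.Nat.Induction using (<-wellFounded)
open import Data.Nat.Properties using (_<?_; ≮⇒≥; <-trans; <-≤-trans; n≮0; ≤-reflexive)
open import Data.Product using (∃; _×_; _,_; proj₁; proj₂)
open import Data.Sum using (_⊎_; inj₁; inj₂; [_,_]′)
open import Data.Vec using ([]; _∷_; lookup; tabulate; here; there)
open import Data.Vec.Properties
  using ( lookup-zipWith; lookup-replicate; lookup∘tabulate; []=⇒lookup; lookup⇒[]=
        ; zipWith-assoc; zipWith-identityˡ; zipWith-identityʳ)
import Data.Vec.Properties as Vec
open import Data.Vec.Relation.Binary.Pointwise.Extensional using (ext; Pointwise-≡⇒≡)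
open import Function using (_∘_; id)
open import Function.Bundles using (_⇔_; mk⇔; Equivalence)
open import Function.Construct.Composition using (_⇔-∘_)
open import Function.Construct.Symmetry using (⇔-sym)
open import Induction.WellFounded using (Acc; acc)
open import Relation.Binary.PropositionalEquality
open import Relation.Nullary using (¬_; Dec; yes; no; contradiction)
open import Relation.Nullary.Decidable using (_×-dec_; _→-dec_; ¬?; decidable-stable)
import Relation.Nullary.Decidable as Dec

open import Algebra.Properties.Semiring.Sum (CommutativeRing.semiring xor-∧-commutativeRing)
  using (sum; sum-cong-≗; sum-replicate-zero; ∑-distrib-+; ∑-comm; *-distribˡ-sum; *-distribʳ-sum; sum-permute)
module ⊕ = CommutativeSemigroupProperties (CommutativeRing.+-commutativeSemigroup xor-∧-commutativeRing)
module ∧ = CommutativeSemigroupProperties (CommutativeRing.*-commutativeSemigroup xor-∧-commutativeRing)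

open ≡-Reasoning

private
  variable
    n : ℕ

-- Subsets as vectors over GF(2)

xorSum≡sum : (f : Fin n → Bool) → xorSum f ≡ sum f
xorSum≡sum {ℕ.zero} f = refl
xorSum≡sum {suc n}  f = cong (f zero xor_) (xorSum≡sum (f ∘ suc))

sum-zero : {f : Fin n → Bool} → (∀ k → f k ≡ false) → sum f ≡ false
sum-zero {n} f≡false = trans (sum-cong-≗ f≡false) (sum-replicate-zero n)

Subset-ext : {X Y : Subset n} → (∀ k → lookup X k ≡ lookup Y k) → X ≡ Y
Subset-ext X≗Y = Pointwise-≡⇒≡ (ext X≗Y)

∈-resp-lookup : ∀ {X Y : Subset n} {k} → lookup X k ≡ lookup Y k → k ∈ X → k ∈ Y
∈-resp-lookup {Y = Y} {k} Xk≡Yk k∈X = lookup⇒[]= k Y (trans (sym Xk≡Yk) ([]=⇒lookup k∈X))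

lookup≡false⇒∉ : ∀ {X : Subset n} {k} → lookup X k ≡ false → k ∉ X
lookup≡false⇒∉ Xk≡false k∈X = contradiction (trans (sym ([]=⇒lookup k∈X)) Xk≡false) λ ()

∉⇒lookup≡false : ∀ {X : Subset n} {k} → k ∉ X → lookup X k ≡ false
∉⇒lookup≡false {X = X} {k} k∉X = ¬-not (k∉X ∘ lookup⇒[]= k X)

lookup-∅ : (k : Fin n) → lookup ∅ k ≡ false
lookup-∅ k = lookup-replicate k false

lookup-Δ : (X Y : Subset n) (k : Fin n) → lookup (X Δ Y) k ≡ lookup X k xor lookup Y k
lookup-Δ X Y k = lookup-zipWith _xor_ k X Y

lookup-⁅x⁆-x : (x : Fin n) → lookup ⁅ x ⁆ x ≡ true
lookup-⁅x⁆-x x = []=⇒lookup (x∈⁅x⁆ x)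

lookup-⁅x⁆-y : ∀ {x y : Fin n} → x ≢ y → lookup ⁅ x ⁆ y ≡ false
lookup-⁅x⁆-y {x = x} x≢y = ∉⇒lookup≡false (x≢y ∘ sym ∘ x∈⁅y⁆⇒x≡y x)

⁅x⁆≢∅ : (x : Fin n) → ⁅ x ⁆ ≢ ∅
⁅x⁆≢∅ x ⁅x⁆≡∅ = ∉⊥ (subst (x ∈_) ⁅x⁆≡∅ (x∈⁅x⁆ x))

⊆⁅x⁆⇒≡⁅x⁆ : ∀ {Z : Subset n} {x} → Z ⊆ ⁅ x ⁆ → Z ≢ ∅ → Z ≡ ⁅ x ⁆
⊆⁅x⁆⇒≡⁅x⁆ {Z = Z} {x} Z⊆⁅x⁆ Z≢∅ with nonempty? Z
... | no  Z-empty   = ⊥-elim (Z≢∅ (Empty-unique Z-empty))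
... | yes (y , y∈Z) = ⊆-antisym Z⊆⁅x⁆ ⁅x⁆⊆Z
  where
  ⁅x⁆⊆Z : ⁅ x ⁆ ⊆ Z
  ⁅x⁆⊆Z k∈⁅x⁆ = subst (_∈ Z) (trans (x∈⁅y⁆⇒x≡y x (Z⊆⁅x⁆ y∈Z)) (sym (x∈⁅y⁆⇒x≡y x k∈⁅x⁆))) y∈Z

Δ-identityʳ : (X : Subset n) → X Δ ∅ ≡ X
Δ-identityʳ = zipWith-identityʳ xor-identityʳ

Δ-self : (X : Subset n) → X Δ X ≡ ∅
Δ-self []      = refl
Δ-self (x ∷ X) = cong₂ _∷_ (xor-same x) (Δ-self X)

Δ-cancelˡ : (A X : Subset n) → A Δ (A Δ X) ≡ X
Δ-cancelˡ A X = begin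
  A Δ (A Δ X)  ≡⟨ zipWith-assoc xor-assoc A A X ⟨
  (A Δ A) Δ X  ≡⟨ cong (_Δ X) (Δ-self A) ⟩
  ∅ Δ X        ≡⟨ zipWith-identityˡ xor-identityˡ X ⟩
  X            ∎

_·_ : Bool → Subset n → Subset n
b · X = if b then X else ∅

lookup-· : ∀ b (X : Subset n) k → lookup (b · X) k ≡ b ∧ lookup X k
lookup-· true  X k = refl
lookup-· false X k = lookup-∅ k

lookup-Δ·⁅x⁆ : ∀ (Z : Subset n) b {x k} → x ≢ k → lookup (Z Δ (b · ⁅ x ⁆)) k ≡ lookup Z k
lookup-Δ·⁅x⁆ Z b {x} {k} x≢k = begin
  lookup (Z Δ (b · ⁅ x ⁆)) k           ≡⟨ lookup-Δ Z (b · ⁅ x ⁆) k ⟩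
  lookup Z k xor lookup (b · ⁅ x ⁆) k  ≡⟨ cong (lookup Z k xor_) (lookup-· b ⁅ x ⁆ k) ⟩
  lookup Z k xor (b ∧ lookup ⁅ x ⁆ k)  ≡⟨ cong (λ c → lookup Z k xor (b ∧ c)) (lookup-⁅x⁆-y x≢k) ⟩
  lookup Z k xor (b ∧ false)           ≡⟨ cong (lookup Z k xor_) (∧-zeroʳ b) ⟩
  lookup Z k xor false                 ≡⟨ xor-identityʳ (lookup Z k) ⟩
  lookup Z k                           ∎

lookup-Δ⁅x⁆-y : ∀ (Z : Subset n) {x k} → x ≢ k → lookup (Z Δ ⁅ x ⁆) k ≡ lookup Z k
lookup-Δ⁅x⁆-y Z = lookup-Δ·⁅x⁆ Z true

lookup-Δ⁅x⁆-x : ∀ (Z : Subset n) {x} → x ∈ Z → lookup (Z Δ ⁅ x ⁆) x ≡ false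
lookup-Δ⁅x⁆-x Z {x} x∈Z rewrite lookup-Δ Z ⁅ x ⁆ x | []=⇒lookup x∈Z | lookup-⁅x⁆-x x = refl

x∈p⇒∣pΔ⁅x⁆∣<∣p∣ : ∀ {p : Subset n} {x} → x ∈ p → ∣ p Δ ⁅ x ⁆ ∣ < ∣ p ∣
x∈p⇒∣pΔ⁅x⁆∣<∣p∣ {p = true ∷ p}  here        = s≤s (≤-reflexive (cong ∣_∣ (Δ-identityʳ p)))
x∈p⇒∣pΔ⁅x⁆∣<∣p∣ {p = true ∷ p}  (there x∈p) = s≤s (x∈p⇒∣pΔ⁅x⁆∣<∣p∣ x∈p)
x∈p⇒∣pΔ⁅x⁆∣<∣p∣ {p = false ∷ p} (there x∈p) = x∈p⇒∣pΔ⁅x⁆∣<∣p∣ x∈p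

lookup-image : (π : Permutation′ n) (X : Subset n) (j : Fin n) → lookup (image π X) j ≡ lookup X (π ⟨$⟩ˡ j)
lookup-image π X = lookup∘tabulate (lookup X ∘ (π ⟨$⟩ˡ_))

image-Δ : (π : Permutation′ n) (X Y : Subset n) → image π (X Δ Y) ≡ image π X Δ image π Y
image-Δ π X Y = Subset-ext λ j → begin
  lookup (image π (X Δ Y)) j
    ≡⟨ lookup-image π (X Δ Y) j ⟩
  lookup (X Δ Y) (π ⟨$⟩ˡ j)
    ≡⟨ lookup-Δ X Y (π ⟨$⟩ˡ j) ⟩
  lookup X (π ⟨$⟩ˡ j) xor lookup Y (π ⟨$⟩ˡ j)
    ≡⟨ cong₂ _xor_ (lookup-image π X j) (lookup-image π Y j) ⟨
  lookup (image π X) j xor lookup (image π Y) j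
    ≡⟨ lookup-Δ (image π X) (image π Y) j ⟨
  lookup (image π X Δ image π Y) j
    ∎

image-⁅x⁆ : (π : Permutation′ n) (x : Fin n) → image π ⁅ x ⁆ ≡ ⁅ π ⟨$⟩ʳ x ⁆
image-⁅x⁆ π x = Subset-ext λ j → trans (lookup-image π ⁅ x ⁆ j) (agree j)
  where
  agree : ∀ j → lookup ⁅ x ⁆ (π ⟨$⟩ˡ j) ≡ lookup ⁅ π ⟨$⟩ʳ x ⁆ j
  agree j with π ⟨$⟩ʳ x ≟ j
  ... | yes refl = trans (cong (lookup ⁅ x ⁆) (inverseˡ π))
                         (trans (lookup-⁅x⁆-x x) (sym (lookup-⁅x⁆-x (π ⟨$⟩ʳ x))))
  ... | no  πx≢j = trans (lookup-⁅x⁆-y (πx≢j ∘ x≡π⁻¹j⇒πx≡j)) (sym (lookup-⁅x⁆-y πx≢j))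
    where
    x≡π⁻¹j⇒πx≡j : x ≡ π ⟨$⟩ˡ j → π ⟨$⟩ʳ x ≡ j
    x≡π⁻¹j⇒πx≡j x≡π⁻¹j = trans (cong (π ⟨$⟩ʳ_) x≡π⁻¹j) (inverseʳ π)

parity : Subset n → Bool
parity X = sum (lookup X)

parity-Δ : (X Y : Subset n) → parity (X Δ Y) ≡ parity X xor parity Y
parity-Δ X Y = trans (sum-cong-≗ (lookup-Δ X Y)) (∑-distrib-+ (lookup X) (lookup Y))

parity-image : (π : Permutation′ n) (X : Subset n) → parity (image π X) ≡ parity X
parity-image π X = trans (sum-cong-≗ (lookup-image π X)) (sym (sum-permute (lookup X) (flip π)))

parity-∅ : ∀ n → parity (∅ {n}) ≡ false
parity-∅ n = sum-zero (lookup-∅ {n})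

sum-⁅x⁆ : (f : Fin n → Bool) (x : Fin n) → sum (λ k → lookup ⁅ x ⁆ k ∧ f k) ≡ f x
sum-⁅x⁆ f zero    = trans (cong (f zero xor_) (sum-zero λ k → cong (_∧ f (suc k)) (lookup-∅ k)))
                          (xor-identityʳ (f zero))
sum-⁅x⁆ f (suc x) = sum-⁅x⁆ (f ∘ suc) x

parity-⁅x⁆ : (x : Fin n) → parity ⁅ x ⁆ ≡ true
parity-⁅x⁆ x = trans (sum-cong-≗ λ k → sym (∧-identityʳ (lookup ⁅ x ⁆ k))) (sum-⁅x⁆ (λ _ → true) x)

parity≡false⇒even : (X : Subset n) → parity X ≡ false → 2 ∣ ∣ X ∣
parity≡true⇒odd   : (X : Subset n) → parity X ≡ true  → 2 ∣ suc (∣ X ∣)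

parity≡false⇒even []          _ = 2 ∣0
parity≡false⇒even (false ∷ X) p = parity≡false⇒even X p
parity≡false⇒even (true ∷ X)  p = parity≡true⇒odd X (not-injective p)

parity≡true⇒odd (false ∷ X) p = parity≡true⇒odd X p
parity≡true⇒odd (true ∷ X)  p = ∣m∣n⇒∣m+n ∣-refl (parity≡false⇒even X (not-injective p))

-- Matrices and forms over GF(2)

mulVec≡sum : (C : Matrix n) (x : Subset n) (k : Fin n) → mulVec C x k ≡ sum (λ l → C k l ∧ lookup x l)
mulVec≡sum C x k = xorSum≡sum (λ l → C k l ∧ lookup x l)

mulVec-Δ : (C : Matrix n) (x y : Subset n) (k : Fin n) → mulVec C (x Δ y) k ≡ mulVec C x k xor mulVec C y k
mulVec-Δ C x y k = begin
  mulVec C (x Δ y) k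
    ≡⟨ mulVec≡sum C (x Δ y) k ⟩
  sum (λ l → C k l ∧ lookup (x Δ y) l)
    ≡⟨ sum-cong-≗ distrib ⟩
  sum (λ l → (C k l ∧ lookup x l) xor (C k l ∧ lookup y l))
    ≡⟨ ∑-distrib-+ (λ l → C k l ∧ lookup x l) (λ l → C k l ∧ lookup y l) ⟩
  sum (λ l → C k l ∧ lookup x l) xor sum (λ l → C k l ∧ lookup y l)
    ≡⟨ cong₂ _xor_ (mulVec≡sum C x k) (mulVec≡sum C y k) ⟨
  mulVec C x k xor mulVec C y k
    ∎
  where
  distrib : ∀ l → C k l ∧ lookup (x Δ y) l ≡ (C k l ∧ lookup x l) xor (C k l ∧ lookup y l)
  distrib l = trans (cong (C k l ∧_) (lookup-Δ x y l)) (∧-distribˡ-xor (C k l) (lookup x l) (lookup y l))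

mulVec-∅ : (C : Matrix n) (k : Fin n) → mulVec C ∅ k ≡ false
mulVec-∅ C k = trans (mulVec≡sum C ∅ k) (sum-zero λ l → trans (cong (C k l ∧_) (lookup-∅ l)) (∧-zeroʳ (C k l)))

mulVec-· : (C : Matrix n) (b : Bool) (x : Subset n) (k : Fin n) → mulVec C (b · x) k ≡ b ∧ mulVec C x k
mulVec-· C true  x k = refl
mulVec-· C false x k = mulVec-∅ C k

mulVec-⁅x⁆ : (C : Matrix n) (x k : Fin n) → mulVec C ⁅ x ⁆ k ≡ C k x
mulVec-⁅x⁆ C x k = begin
  mulVec C ⁅ x ⁆ k                       ≡⟨ mulVec≡sum C ⁅ x ⁆ k ⟩
  sum (λ l → C k l ∧ lookup ⁅ x ⁆ l)     ≡⟨ sum-cong-≗ (λ l → ∧-comm (C k l) (lookup ⁅ x ⁆ l)) ⟩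
  sum (λ l → lookup ⁅ x ⁆ l ∧ C k l)     ≡⟨ sum-⁅x⁆ (C k) x ⟩
  C k x                                  ∎

form : Matrix n → Subset n → Subset n → Bool
form C x y = sum (λ k → lookup x k ∧ mulVec C y k)

quad : Matrix n → Subset n → Bool
quad C x = form C x x

form-Δˡ : (C : Matrix n) (x x′ y : Subset n) → form C (x Δ x′) y ≡ form C x y xor form C x′ y
form-Δˡ C x x′ y =
  trans (sum-cong-≗ distrib) (∑-distrib-+ (λ k → lookup x k ∧ mulVec C y k) (λ k → lookup x′ k ∧ mulVec C y k))
  where
  distrib : ∀ k → lookup (x Δ x′) k ∧ mulVec C y k ≡ (lookup x k ∧ mulVec C y k) xor (lookup x′ k ∧ mulVec C y k)
  distrib k = trans (cong (_∧ mulVec C y k) (lookup-Δ x x′ k))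
                    (∧-distribʳ-xor (mulVec C y k) (lookup x k) (lookup x′ k))

form-Δʳ : (C : Matrix n) (x y y′ : Subset n) → form C x (y Δ y′) ≡ form C x y xor form C x y′
form-Δʳ C x y y′ =
  trans (sum-cong-≗ distrib) (∑-distrib-+ (λ k → lookup x k ∧ mulVec C y k) (λ k → lookup x k ∧ mulVec C y′ k))
  where
  distrib : ∀ k → lookup x k ∧ mulVec C (y Δ y′) k ≡ (lookup x k ∧ mulVec C y k) xor (lookup x k ∧ mulVec C y′ k)
  distrib k = trans (cong (lookup x k ∧_) (mulVec-Δ C y y′ k))
                    (∧-distribˡ-xor (lookup x k) (mulVec C y k) (mulVec C y′ k))

form-comm : {C : Matrix n} → Symmetric C → (x y : Subset n) → form C x y ≡ form C y x
form-comm {C = C} C-sym x y = begin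
  sum (λ k → lookup x k ∧ mulVec C y k)
    ≡⟨ sum-cong-≗ (λ k → cong (lookup x k ∧_) (mulVec≡sum C y k)) ⟩
  sum (λ k → lookup x k ∧ sum (λ l → C k l ∧ lookup y l))
    ≡⟨ sum-cong-≗ (λ k → *-distribˡ-sum (lookup x k) (λ l → C k l ∧ lookup y l)) ⟩
  sum (λ k → sum (λ l → lookup x k ∧ (C k l ∧ lookup y l)))
    ≡⟨ ∑-comm (λ k l → lookup x k ∧ (C k l ∧ lookup y l)) ⟩
  sum (λ l → sum (λ k → lookup x k ∧ (C k l ∧ lookup y l)))
    ≡⟨ sum-cong-≗ (λ l → sum-cong-≗ (λ k → transpose k l)) ⟩
  sum (λ l → sum (λ k → lookup y l ∧ (C l k ∧ lookup x k)))
    ≡⟨ sum-cong-≗ (λ l → *-distribˡ-sum (lookup y l) (λ k → C l k ∧ lookup x k)) ⟨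
  sum (λ l → lookup y l ∧ sum (λ k → C l k ∧ lookup x k))
    ≡⟨ sum-cong-≗ (λ l → cong (lookup y l ∧_) (mulVec≡sum C x l)) ⟨
  sum (λ l → lookup y l ∧ mulVec C x l)
    ∎
  where
  transpose : ∀ k l → lookup x k ∧ (C k l ∧ lookup y l) ≡ lookup y l ∧ (C l k ∧ lookup x k)
  transpose k l = trans (cong (λ c → lookup x k ∧ (c ∧ lookup y l)) (C-sym k l))
                        (∧.x∙yz≈z∙yx (lookup x k) (C l k) (lookup y l))

-- The cross terms form C x y and form C y x are equal, hence cancel over GF(2).
quad-Δ : {C : Matrix n} → Symmetric C → (x y : Subset n) → quad C (x Δ y) ≡ quad C x xor quad C y
quad-Δ {C = C} C-sym x y = begin
  form C (x Δ y) (x Δ y)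
    ≡⟨ form-Δˡ C x y (x Δ y) ⟩
  form C x (x Δ y) xor form C y (x Δ y)
    ≡⟨ cong₂ _xor_ (form-Δʳ C x x y) (form-Δʳ C y x y) ⟩
  (quad C x xor form C x y) xor (form C y x xor quad C y)
    ≡⟨ cong ((quad C x xor form C x y) xor_) (xor-comm (form C y x) (quad C y)) ⟩
  (quad C x xor form C x y) xor (quad C y xor form C y x)
    ≡⟨ ⊕.interchange (quad C x) (form C x y) (quad C y) (form C y x) ⟩
  (quad C x xor quad C y) xor (form C x y xor form C y x)
    ≡⟨ cong (λ b → (quad C x xor quad C y) xor (form C x y xor b)) (form-comm C-sym y x) ⟩
  (quad C x xor quad C y) xor (form C x y xor form C x y)
    ≡⟨ cong ((quad C x xor quad C y) xor_) (xor-same (form C x y)) ⟩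
  (quad C x xor quad C y) xor false
    ≡⟨ xor-identityʳ (quad C x xor quad C y) ⟩
  quad C x xor quad C y
    ∎

quad-⁅x⁆ : (C : Matrix n) (x : Fin n) → quad C ⁅ x ⁆ ≡ C x x
quad-⁅x⁆ C x = trans (sum-⁅x⁆ (mulVec C ⁅ x ⁆) x) (mulVec-⁅x⁆ C x x)

InKernel : Matrix n → Subset n → Subset n → Set
InKernel C U x = x ⊆ U × (∀ k → k ∈ U → mulVec C x k ≡ false)

inKernel? : (C : Matrix n) (U x : Subset n) → Dec (InKernel C U x)
inKernel? C U x = (x ⊆? U) ×-dec all? (λ k → (k ∈? U) →-dec (mulVec C x k Bool.≟ false))

quad-kernel : ∀ {C : Matrix n} {U x} → InKernel C U x → quad C x ≡ false
quad-kernel {C = C} {x = x} (x⊆U , x-ker) = sum-zero term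
  where
  term : ∀ k → lookup x k ∧ mulVec C x k ≡ false
  term k with lookup x k in xk
  ... | false = refl
  ... | true  = x-ker k (x⊆U (lookup⇒[]= k x xk))

nonSingular-or-kernel : (C : Matrix n) (U : Subset n) →
                        NonSingular C U ⊎ ∃ λ x → InKernel C U x × x ≢ ∅
nonSingular-or-kernel C U with anySubset? (λ x → inKernel? C U x ×-dec ¬? (Vec.≡-dec Bool._≟_ x ∅))
... | yes kernel-vector = inj₂ kernel-vector
... | no  none          = inj₁ λ x x⊆U x-ker →
  decidable-stable (Vec.≡-dec Bool._≟_ x ∅) (λ x≢∅ → none (x , (x⊆U , x-ker) , x≢∅))

nonSingular? : (C : Matrix n) (U : Subset n) → Dec (NonSingular C U)
nonSingular? C U = [ yes , singular ]′ (nonSingular-or-kernel C U)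
  where
  singular : (∃ λ x → InKernel C U x × x ≢ ∅) → Dec (NonSingular C U)
  singular (x , (x⊆U , x-ker) , x≢∅) = no λ C[U]-nonSingular → x≢∅ (C[U]-nonSingular x x⊆U x-ker)

singular⇒kernel : ∀ {C : Matrix n} {U} → ¬ NonSingular C U → ∃ λ x → InKernel C U x × x ≢ ∅
singular⇒kernel {C = C} {U} singular = [ ⊥-elim ∘ singular , id ]′ (nonSingular-or-kernel C U)

-- Alternating matrices

-- The w e span: subtracting w e removes e from P x, and P is injective.
additive-vanishes-on-preimage-basis :
  ∀ {m} (P : Subset m → Subset n) (f : Subset m → Bool) (w : Fin n → Subset m) →
  (∀ x y → P (x Δ y) ≡ P x Δ P y) → (∀ x → P x ≡ ∅ → x ≡ ∅) →
  (∀ x y → f (x Δ y) ≡ f x xor f y) →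
  (∀ e → P (w e) ≡ ⁅ e ⁆) → (∀ e → f (w e) ≡ false) →
  ∀ x → f x ≡ false
additive-vanishes-on-preimage-basis P f w P-Δ P-injective f-Δ P-w f-w x = go x (<-wellFounded ∣ P x ∣)
  where
  f-∅ : f ∅ ≡ false
  f-∅ = begin
    f ∅          ≡⟨ cong f (Δ-self ∅) ⟨
    f (∅ Δ ∅)    ≡⟨ f-Δ ∅ ∅ ⟩
    f ∅ xor f ∅  ≡⟨ xor-same (f ∅) ⟩
    false        ∎

  go : ∀ x → Acc _<_ ∣ P x ∣ → f x ≡ false
  go x (acc rs) with nonempty? (P x)
  ... | no  Px-empty   = trans (cong f (P-injective x (Empty-unique Px-empty))) f-∅
  ... | yes (e , e∈Px) = begin
    f x              ≡⟨ xor-identityʳ (f x) ⟨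
    f x xor false    ≡⟨ cong (f x xor_) (f-w e) ⟨
    f x xor f (w e)  ≡⟨ f-Δ x (w e) ⟨
    f (x Δ w e)      ≡⟨ go (x Δ w e) (rs smaller) ⟩
    false            ∎
    where
    smaller : ∣ P (x Δ w e) ∣ < ∣ P x ∣
    smaller = subst (λ Z → ∣ Z ∣ < ∣ P x ∣)
                    (sym (trans (P-Δ x (w e)) (cong (P x Δ_) (P-w e))))
                    (x∈p⇒∣pΔ⁅x⁆∣<∣p∣ e∈Px)

module _ {C : Matrix n} (C-sym : Symmetric C) {S : Subset n} (S-nonSingular : NonSingular C S)
         (S-flip-singular : ∀ e → ¬ NonSingular C (S Δ ⁅ e ⁆)) where

  -- In the coordinates P (injective as C[S] is non-singular) the kernel vectors w e
  -- of the singular C[S Δ ⁅ e ⁆] become the unit vectors ⁅ e ⁆.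
  private
    p : Subset n → Fin n → Bool
    p x k = if lookup S k then mulVec C x k else lookup x k

    P : Subset n → Subset n
    P x = tabulate (p x)

    p-in : ∀ x {k} → lookup S k ≡ true → p x k ≡ mulVec C x k
    p-in x Sk rewrite Sk = refl

    p-out : ∀ x {k} → lookup S k ≡ false → p x k ≡ lookup x k
    p-out x Sk rewrite Sk = refl

    P-Δ : ∀ x y → P (x Δ y) ≡ P x Δ P y
    P-Δ x y = Subset-ext λ k → begin
      lookup (P (x Δ y)) k               ≡⟨ lookup∘tabulate (p (x Δ y)) k ⟩
      p (x Δ y) k                        ≡⟨ p-Δ k ⟩
      p x k xor p y k                    ≡⟨ cong₂ _xor_ (lookup∘tabulate (p x) k) (lookup∘tabulate (p y) k) ⟨
      lookup (P x) k xor lookup (P y) k  ≡⟨ lookup-Δ (P x) (P y) k ⟨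
      lookup (P x Δ P y) k               ∎
      where
      p-Δ : ∀ k → p (x Δ y) k ≡ p x k xor p y k
      p-Δ k with lookup S k
      ... | true  = mulVec-Δ C x y k
      ... | false = lookup-Δ x y k

    P-injective : ∀ x → P x ≡ ∅ → x ≡ ∅
    P-injective x Px≡∅ = S-nonSingular x x⊆S x-ker
      where
      p≡false : ∀ k → p x k ≡ false
      p≡false k = trans (sym (lookup∘tabulate (p x) k)) (trans (cong (λ Z → lookup Z k) Px≡∅) (lookup-∅ k))

      x⊆S : x ⊆ S
      x⊆S {k} k∈x with lookup S k in Sk
      ... | true  = lookup⇒[]= k S Sk
      ... | false = ⊥-elim (lookup≡false⇒∉ (trans (sym (p-out x {k} Sk)) (p≡false k)) k∈x)

      x-ker : ∀ k → k ∈ S → mulVec C x k ≡ false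
      x-ker k k∈S = trans (sym (p-in x ([]=⇒lookup k∈S))) (p≡false k)

    kernel-vector : ∀ e → ∃ λ x → InKernel C (S Δ ⁅ e ⁆) x × x ≢ ∅
    kernel-vector e = singular⇒kernel (S-flip-singular e)

    w : Fin n → Subset n
    w e = proj₁ (kernel-vector e)

    w-kernel : ∀ e → InKernel C (S Δ ⁅ e ⁆) (w e)
    w-kernel e = proj₁ (proj₂ (kernel-vector e))

    w≢∅ : ∀ e → w e ≢ ∅
    w≢∅ e = proj₂ (proj₂ (kernel-vector e))

    p-w : ∀ e {k} → e ≢ k → p (w e) k ≡ false
    p-w e {k} e≢k with lookup S k in Sk
    ... | true  = proj₂ (w-kernel e) k (∈-resp-lookup (sym (lookup-Δ⁅x⁆-y S e≢k)) (lookup⇒[]= k S Sk))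
    ... | false = ∉⇒lookup≡false (lookup≡false⇒∉ (trans (lookup-Δ⁅x⁆-y S e≢k) Sk) ∘ proj₁ (w-kernel e))

    P-w⊆⁅e⁆ : ∀ e → P (w e) ⊆ ⁅ e ⁆
    P-w⊆⁅e⁆ e {k} k∈Pw with e ≟ k
    ... | yes refl = x∈⁅x⁆ e
    ... | no  e≢k  = ⊥-elim (lookup≡false⇒∉ (trans (lookup∘tabulate (p (w e)) k) (p-w e e≢k)) k∈Pw)

    P-w : ∀ e → P (w e) ≡ ⁅ e ⁆
    P-w e = ⊆⁅x⁆⇒≡⁅x⁆ (P-w⊆⁅e⁆ e) (w≢∅ e ∘ P-injective (w e))

  diagonal-zero : ∀ i → C i i ≡ false
  diagonal-zero i = trans (sym (quad-⁅x⁆ C i))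
    (additive-vanishes-on-preimage-basis P (quad C) w P-Δ P-injective (quad-Δ C-sym) P-w
      (quad-kernel ∘ w-kernel) ⁅ i ⁆)

nonSingular⇒partner : ∀ {C : Matrix n} → Symmetric C → ∀ {T} → NonSingular C T →
                      ∀ {i} → i ∈ T → ∃ λ j → j ∈ T × C i j ≡ true
nonSingular⇒partner {C = C} C-sym {T} T-nonSingular {i} i∈T
  with any? (λ j → (j ∈? T) ×-dec (C i j Bool.≟ true))
... | yes partner = partner
... | no  none    = ⊥-elim (⁅x⁆≢∅ i (T-nonSingular ⁅ i ⁆ ⁅i⁆⊆T ⁅i⁆-kernel))
  where
  ⁅i⁆⊆T : ⁅ i ⁆ ⊆ T
  ⁅i⁆⊆T k∈⁅i⁆ = subst (_∈ T) (sym (x∈⁅y⁆⇒x≡y i k∈⁅i⁆)) i∈T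

  ⁅i⁆-kernel : ∀ k → k ∈ T → mulVec C ⁅ i ⁆ k ≡ false
  ⁅i⁆-kernel k k∈T = trans (mulVec-⁅x⁆ C i k) (¬-not λ Cki → none (k , k∈T , trans (C-sym i k) Cki))

-- Splitting off the hyperbolic pair {i, j}: x ↦ x̂ = x + (C x)ⱼ ⁅ i ⁆ + (C x)ᵢ ⁅ j ⁆
-- lands in the C-orthogonal complement of span {⁅ i ⁆, ⁅ j ⁆} and satisfies C x̂ = C′ x.
module HyperbolicReduction
  {C : Matrix n} (C-sym : Symmetric C) (C-diag : ∀ k → C k k ≡ false)
  {T : Subset n} (T-nonSingular : NonSingular C T)
  {i j : Fin n} (i∈T : i ∈ T) (j∈T : j ∈ T) (Cij : C i j ≡ true) where

  i≢j : i ≢ j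
  i≢j refl = contradiction (trans (sym Cij) (C-diag i)) λ ()

  C′ : Matrix n
  C′ k l = (C k l xor (C j l ∧ C k i)) xor (C i l ∧ C k j)

  T′ : Subset n
  T′ = (T Δ ⁅ i ⁆) Δ ⁅ j ⁆

  private
    transposed : ∀ a b c d → C a b ∧ C c d ≡ C d c ∧ C b a
    transposed a b c d = trans (∧-comm (C a b) (C c d)) (cong₂ _∧_ (C-sym c d) (C-sym a b))

  C′-symmetric : Symmetric C′
  C′-symmetric k l = begin
    (C k l xor (C j l ∧ C k i)) xor (C i l ∧ C k j)
      ≡⟨ ⊕.xy∙z≈xz∙y (C k l) (C j l ∧ C k i) (C i l ∧ C k j) ⟩
    (C k l xor (C i l ∧ C k j)) xor (C j l ∧ C k i)
      ≡⟨ cong₂ (λ a b → (a xor b) xor (C j l ∧ C k i)) (C-sym k l) (transposed i l k j) ⟩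
    (C l k xor (C j k ∧ C l i)) xor (C j l ∧ C k i)
      ≡⟨ cong ((C l k xor (C j k ∧ C l i)) xor_) (transposed j l k i) ⟩
    (C l k xor (C j k ∧ C l i)) xor (C i k ∧ C l j)
      ∎

  C′-diagonal : ∀ k → C′ k k ≡ false
  C′-diagonal k rewrite C-diag k | transposed j k k i = xor-same (C i k ∧ C k j)

  C′-row-i : ∀ l → C′ i l ≡ false
  C′-row-i l rewrite C-diag i | Cij | ∧-zeroʳ (C j l) | ∧-identityʳ (C i l) | xor-identityʳ (C i l) =
    xor-same (C i l)

  C′-row-j : ∀ l → C′ j l ≡ false
  C′-row-j l rewrite C-diag j | C-sym j i | Cij | ∧-zeroʳ (C i l) | ∧-identityʳ (C j l) | xor-same (C j l) =
    refl

  mulVec-C′ : ∀ x k → mulVec C′ x k ≡ (mulVec C x k xor (mulVec C x j ∧ C k i)) xor (mulVec C x i ∧ C k j)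
  mulVec-C′ x k = begin
    mulVec C′ x k
      ≡⟨ mulVec≡sum C′ x k ⟩
    sum (λ l → C′ k l ∧ lookup x l)
      ≡⟨ sum-cong-≗ expand ⟩
    sum (λ l → (Cx k l xor (Cx j l ∧ C k i)) xor (Cx i l ∧ C k j))
      ≡⟨ ∑-distrib-+ (λ l → Cx k l xor (Cx j l ∧ C k i)) (λ l → Cx i l ∧ C k j) ⟩
    sum (λ l → Cx k l xor (Cx j l ∧ C k i)) xor sum (λ l → Cx i l ∧ C k j)
      ≡⟨ cong (_xor sum (λ l → Cx i l ∧ C k j)) (∑-distrib-+ (Cx k) (λ l → Cx j l ∧ C k i)) ⟩
    (sum (Cx k) xor sum (λ l → Cx j l ∧ C k i)) xor sum (λ l → Cx i l ∧ C k j)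
      ≡⟨ cong₂ (λ a b → (sum (Cx k) xor a) xor b) (*-distribʳ-sum (C k i) (Cx j)) (*-distribʳ-sum (C k j) (Cx i)) ⟨
    (sum (Cx k) xor (sum (Cx j) ∧ C k i)) xor (sum (Cx i) ∧ C k j)
      ≡⟨ cong₂ (λ a b → (a xor (b ∧ C k i)) xor (sum (Cx i) ∧ C k j)) (mulVec≡sum C x k) (mulVec≡sum C x j) ⟨
    (mulVec C x k xor (mulVec C x j ∧ C k i)) xor (sum (Cx i) ∧ C k j)
      ≡⟨ cong (λ a → (mulVec C x k xor (mulVec C x j ∧ C k i)) xor (a ∧ C k j)) (mulVec≡sum C x i) ⟨
    (mulVec C x k xor (mulVec C x j ∧ C k i)) xor (mulVec C x i ∧ C k j)
      ∎
    where
    Cx : Fin n → Fin n → Bool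
    Cx a l = C a l ∧ lookup x l

    expand : ∀ l → C′ k l ∧ lookup x l ≡ (Cx k l xor (Cx j l ∧ C k i)) xor (Cx i l ∧ C k j)
    expand l rewrite ∧-distribʳ-xor (lookup x l) (C k l xor (C j l ∧ C k i)) (C i l ∧ C k j)
                   | ∧-distribʳ-xor (lookup x l) (C k l) (C j l ∧ C k i)
                   | ∧.xy∙z≈xz∙y (C j l) (C k i) (lookup x l)
                   | ∧.xy∙z≈xz∙y (C i l) (C k j) (lookup x l) = refl

  mulVec-C′-i : ∀ x → mulVec C′ x i ≡ false
  mulVec-C′-i x = trans (mulVec≡sum C′ x i) (sum-zero λ l → cong (_∧ lookup x l) (C′-row-i l))

  mulVec-C′-j : ∀ x → mulVec C′ x j ≡ false
  mulVec-C′-j x = trans (mulVec≡sum C′ x j) (sum-zero λ l → cong (_∧ lookup x l) (C′-row-j l))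

  lookup-T′ : ∀ {k} → i ≢ k → j ≢ k → lookup T′ k ≡ lookup T k
  lookup-T′ i≢k j≢k = trans (lookup-Δ⁅x⁆-y (T Δ ⁅ i ⁆) j≢k) (lookup-Δ⁅x⁆-y T i≢k)

  i∉T′ : i ∉ T′
  i∉T′ = lookup≡false⇒∉ (trans (lookup-Δ⁅x⁆-y (T Δ ⁅ i ⁆) (i≢j ∘ sym)) (lookup-Δ⁅x⁆-x T i∈T))

  j∉T′ : j ∉ T′
  j∉T′ = lookup≡false⇒∉ (lookup-Δ⁅x⁆-x (T Δ ⁅ i ⁆) (∈-resp-lookup (sym (lookup-Δ⁅x⁆-y T i≢j)) j∈T))

  T′-nonSingular : NonSingular C′ T′
  T′-nonSingular x x⊆T′ x-ker = Subset-ext x≗∅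
    where
    x̂ : Subset n
    x̂ = (x Δ (mulVec C x j · ⁅ i ⁆)) Δ (mulVec C x i · ⁅ j ⁆)

    lookup-x̂ : ∀ {k} → i ≢ k → j ≢ k → lookup x̂ k ≡ lookup x k
    lookup-x̂ i≢k j≢k = trans (lookup-Δ·⁅x⁆ (x Δ (mulVec C x j · ⁅ i ⁆)) (mulVec C x i) j≢k)
                             (lookup-Δ·⁅x⁆ x (mulVec C x j) i≢k)

    mulVec-x̂ : ∀ k → mulVec C x̂ k ≡ mulVec C′ x k
    mulVec-x̂ k = begin
      mulVec C x̂ k
        ≡⟨ mulVec-Δ C (x Δ (a · ⁅ i ⁆)) (b · ⁅ j ⁆) k ⟩
      mulVec C (x Δ (a · ⁅ i ⁆)) k xor mulVec C (b · ⁅ j ⁆) k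
        ≡⟨ cong (_xor mulVec C (b · ⁅ j ⁆) k) (mulVec-Δ C x (a · ⁅ i ⁆) k) ⟩
      (mulVec C x k xor mulVec C (a · ⁅ i ⁆) k) xor mulVec C (b · ⁅ j ⁆) k
        ≡⟨ cong₂ (λ u v → (mulVec C x k xor u) xor v) (mulVec-· C a ⁅ i ⁆ k) (mulVec-· C b ⁅ j ⁆ k) ⟩
      (mulVec C x k xor (a ∧ mulVec C ⁅ i ⁆ k)) xor (b ∧ mulVec C ⁅ j ⁆ k)
        ≡⟨ cong₂ (λ u v → (mulVec C x k xor (a ∧ u)) xor (b ∧ v)) (mulVec-⁅x⁆ C i k) (mulVec-⁅x⁆ C j k) ⟩
      (mulVec C x k xor (a ∧ C k i)) xor (b ∧ C k j)
        ≡⟨ mulVec-C′ x k ⟨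
      mulVec C′ x k
        ∎
      where
      a b : Bool
      a = mulVec C x j
      b = mulVec C x i

    x̂⊆T : x̂ ⊆ T
    x̂⊆T {k} k∈x̂ with i ≟ k | j ≟ k
    ... | yes refl | _        = i∈T
    ... | no  _    | yes refl = j∈T
    ... | no  i≢k  | no  j≢k  =
      ∈-resp-lookup (lookup-T′ i≢k j≢k) (x⊆T′ (∈-resp-lookup (lookup-x̂ i≢k j≢k) k∈x̂))

    x̂-kernel : ∀ k → k ∈ T → mulVec C x̂ k ≡ false
    x̂-kernel k k∈T with i ≟ k | j ≟ k
    ... | yes refl | _        = trans (mulVec-x̂ i) (mulVec-C′-i x)
    ... | no  _    | yes refl = trans (mulVec-x̂ j) (mulVec-C′-j x)
    ... | no  i≢k  | no  j≢k  = trans (mulVec-x̂ k) (x-ker k (∈-resp-lookup (sym (lookup-T′ i≢k j≢k)) k∈T))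

    x̂≡∅ : x̂ ≡ ∅
    x̂≡∅ = T-nonSingular x̂ x̂⊆T x̂-kernel

    x≗∅ : ∀ k → lookup x k ≡ lookup ∅ k
    x≗∅ k with i ≟ k | j ≟ k
    ... | yes refl | _        = trans (∉⇒lookup≡false (i∉T′ ∘ x⊆T′)) (sym (lookup-∅ i))
    ... | no  _    | yes refl = trans (∉⇒lookup≡false (j∉T′ ∘ x⊆T′)) (sym (lookup-∅ j))
    ... | no  i≢k  | no  j≢k  = trans (sym (lookup-x̂ i≢k j≢k)) (cong (λ Z → lookup Z k) x̂≡∅)

  ∣T′∣<∣T∣ : ∣ T′ ∣ < ∣ T ∣
  ∣T′∣<∣T∣ = <-trans (x∈p⇒∣pΔ⁅x⁆∣<∣p∣ j∈TΔ⁅i⁆) (x∈p⇒∣pΔ⁅x⁆∣<∣p∣ i∈T)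
    where
    j∈TΔ⁅i⁆ : j ∈ T Δ ⁅ i ⁆
    j∈TΔ⁅i⁆ = ∈-resp-lookup (sym (lookup-Δ⁅x⁆-y T i≢j)) j∈T

  parity-T′ : parity T′ ≡ parity T
  parity-T′ = begin
    parity ((T Δ ⁅ i ⁆) Δ ⁅ j ⁆)         ≡⟨ parity-Δ (T Δ ⁅ i ⁆) ⁅ j ⁆ ⟩
    parity (T Δ ⁅ i ⁆) xor parity ⁅ j ⁆  ≡⟨ cong₂ _xor_ (parity-Δ T ⁅ i ⁆) (parity-⁅x⁆ j) ⟩
    (parity T xor parity ⁅ i ⁆) xor true ≡⟨ cong (λ b → (parity T xor b) xor true) (parity-⁅x⁆ i) ⟩
    (parity T xor true) xor true         ≡⟨ xor-assoc (parity T) true true ⟩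
    parity T xor false                   ≡⟨ xor-identityʳ (parity T) ⟩
    parity T                             ∎

nonSingular⇒parity≡false : ∀ {C : Matrix n} → Symmetric C → (∀ k → C k k ≡ false) →
                           ∀ {T} → NonSingular C T → parity T ≡ false
nonSingular⇒parity≡false {n} C-sym C-diag {T} T-nonSingular =
  go C-sym C-diag T-nonSingular (<-wellFounded ∣ T ∣)
  where
  go : ∀ {C : Matrix n} → Symmetric C → (∀ k → C k k ≡ false) →
       ∀ {T} → NonSingular C T → Acc _<_ ∣ T ∣ → parity T ≡ false
  go C-sym C-diag {T} T-nonSingular (acc rs) with nonempty? T
  ... | no  T-empty   = trans (cong parity (Empty-unique T-empty)) (parity-∅ n)
  ... | yes (i , i∈T) with nonSingular⇒partner C-sym T-nonSingular i∈T
  ...   | j , j∈T , Cij =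
    trans (sym R.parity-T′) (go R.C′-symmetric R.C′-diagonal R.T′-nonSingular (rs R.∣T′∣<∣T∣))
    where module R = HyperbolicReduction C-sym C-diag T-nonSingular i∈T j∈T Cij

-- Set systems and binary delta-matroids

minimum-feasible : (D : SetSystem n) → (∀ X → Dec (Fam D X)) → ∃ (Fam D) → ∃ (Fam (Dmin D))
minimum-feasible D feasible? (X , X-feasible) = go X X-feasible (<-wellFounded ∣ X ∣)
  where
  go : ∀ X → Fam D X → Acc _<_ ∣ X ∣ → ∃ (Fam (Dmin D))
  go X X-feasible (acc rs) with anySubset? (λ Y → feasible? Y ×-dec (∣ Y ∣ <? ∣ X ∣))
  ... | yes (Y , Y-feasible , ∣Y∣<∣X∣) = go Y Y-feasible (rs ∣Y∣<∣X∣)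
  ... | no  none = X , X-feasible , λ Y Y-feasible → ≮⇒≥ (λ ∣Y∣<∣X∣ → none (Y , Y-feasible , ∣Y∣<∣X∣))

ribbonLoops⇒minimum≡∅ : ∀ {D : SetSystem n} → (∀ e → IsRibbonLoop D e) → ∀ {X} → Fam (Dmin D) X → X ≡ ∅
ribbonLoops⇒minimum≡∅ loops {X} X-minimum = Empty-unique λ (e , e∈X) → loops e X X-minimum e∈X

∅-feasible⇒ribbonLoop : ∀ {D : SetSystem n} → Fam D ∅ → ∀ e → IsRibbonLoop D e
∅-feasible⇒ribbonLoop {n} ∅-feasible e X (_ , X-minimum) e∈X =
  n≮0 (<-≤-trans (x∈p⇒∣p-x∣<∣p∣ e∈X) (subst (∣ X ∣ ≤_) (∣⊥∣≡0 n) (X-minimum ∅ ∅-feasible)))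

orientable⇒⁅e⁆-infeasible : ∀ {D : SetSystem n} {e} → IsOrientableRibbonLoop D e → ¬ Fam D ⁅ e ⁆
orientable⇒⁅e⁆-infeasible {D = D} {e} (_ , not-loop-in-twist) ⁅e⁆-feasible =
  not-loop-in-twist (∅-feasible⇒ribbonLoop (subst (Fam D) (sym (Δ-identityʳ ⁅ e ⁆)) ⁅e⁆-feasible) e)

feasible⇔nonSingular : ∀ {D : SetSystem n} {A C π} → (∀ X → Fam (D * A) X ⇔ Fam (DC C) (image π X)) →
                       ∀ X → Fam D X ⇔ NonSingular C (image π (A Δ X))
feasible⇔nonSingular {D = D} {A} iso X =
  iso (A Δ X) ⇔-∘ mk⇔ (subst (Fam D) (sym (Δ-cancelˡ A X))) (subst (Fam D) (Δ-cancelˡ A X))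

binary⇒feasible? : ∀ {D : SetSystem n} → IsBinary D → ∀ X → Dec (Fam D X)
binary⇒feasible? {D = D} (A , C , _ , π , iso) X =
  Dec.map (⇔-sym (feasible⇔nonSingular {D = D} {A} {C} {π} iso X)) (nonSingular? C (image π (A Δ X)))

binary⇒even : ∀ {D : SetSystem n} → IsBinary D → Fam D ∅ → (∀ e → ¬ Fam D ⁅ e ⁆) → IsEven D
binary⇒even {D = D} (A , C , C-sym , π , iso) ∅-feasible no-singleton X Y X-feasible Y-feasible =
  parity≡false⇒even (X Δ Y) (begin
    parity (X Δ Y)         ≡⟨ parity-Δ X Y ⟩
    parity X xor parity Y  ≡⟨ cong₂ _xor_ (feasible-parity X-feasible) (feasible-parity Y-feasible) ⟩
    parity A xor parity A  ≡⟨ xor-same (parity A) ⟩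
    false                  ∎)
  where
  open Equivalence

  representation : ∀ X → Fam D X ⇔ NonSingular C (image π (A Δ X))
  representation = feasible⇔nonSingular {D = D} {A} {C} {π} iso

  S : Subset _
  S = image π A

  S-nonSingular : NonSingular C S
  S-nonSingular = subst (NonSingular C ∘ image π) (Δ-identityʳ A) (to (representation ∅) ∅-feasible)

  S-flip-singular : ∀ f → ¬ NonSingular C (S Δ ⁅ f ⁆)
  S-flip-singular f C[SΔ⁅f⁆]-nonSingular =
    no-singleton e (from (representation ⁅ e ⁆) (subst (NonSingular C) (sym image≡) C[SΔ⁅f⁆]-nonSingular))
    where
    e : Fin _
    e = π ⟨$⟩ˡ f

    image≡ : image π (A Δ ⁅ e ⁆) ≡ S Δ ⁅ f ⁆
    image≡ = trans (image-Δ π A ⁅ e ⁆) (cong (S Δ_) (trans (image-⁅x⁆ π e) (cong ⁅_⁆ (inverseʳ π))))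

  C-diag : ∀ k → C k k ≡ false
  C-diag = diagonal-zero C-sym S-nonSingular S-flip-singular

  feasible-parity : ∀ {X} → Fam D X → parity X ≡ parity A
  feasible-parity {X} X-feasible = begin
    parity X                               ≡⟨ cong parity (Δ-cancelˡ A X) ⟨
    parity (A Δ (A Δ X))                   ≡⟨ parity-Δ A (A Δ X) ⟩
    parity A xor parity (A Δ X)            ≡⟨ cong (parity A xor_) (parity-image π (A Δ X)) ⟨
    parity A xor parity (image π (A Δ X))  ≡⟨ cong (parity A xor_) even-image ⟩
    parity A xor false                     ≡⟨ xor-identityʳ (parity A) ⟩
    parity A                               ∎
    where
    even-image : parity (image π (A Δ X)) ≡ false
    even-image = nonSingular⇒parity≡false C-sym C-diag (to (representation X) X-feasible)

lemma4 : ∀ (n : ℕ) (D : SetSystem n) → IsDeltaMatroid D → IsBinary D →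
    (∀ (e : Fin n) → PrimalTypeU D e) → IsEven D
lemma4 n D (nonempty , _) binary primal-u =
  binary⇒even binary ∅-feasible (λ e → orientable⇒⁅e⁆-infeasible (primal-u e))
  where
  ∅-feasible : Fam D ∅
  ∅-feasible with minimum-feasible D (binary⇒feasible? binary) nonempty
  ... | X , X-minimum = subst (Fam D) (ribbonLoops⇒minimum≡∅ (proj₁ ∘ primal-u) X-minimum) (proj₁ X-minimum)
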